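{- Let $\mathcal{E}$ be a topos which is a model of guarded recursive terms. Then the L\"ob induction principle $\forall p:\Omega.\ (\rhd p\to p)\to p$ is valid in the internal logic of $\mathcal{E}$.
   Context: A model of guarded recursive terms: a category with finite products, an endofunctor $\blacktriangleright$ preserving finite limits and a natural transformation $\mathrm{next}:\mathrm{id}\to\blacktriangleright$ such that every $f:\blacktriangleright X\to X$ has a unique $h:1\to X$ with $f\circ\mathrm{next}\circ h=h$. For a subobject $m:M\to X$, $\rhd m$ is the pullback of $\blacktriangleright m:\blacktriangleright M\to\blacktriangleright X$ along $\mathrm{next}_X:X\to\blacktriangleright X$; this gives order-preserving maps $\rhd:\mathrm{Sub}(X)\to\mathrm{Sub}(X)$, natural in $X$, and hence (by Yoneda) a morphism $\rhd:\Omega\to\Omega$ on the subobject classifier. -}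

module Defs where

open import Level using (Level; _⊔_; suc)
open import Data.Product using (Σ; Σ-syntax; _×_; _,_; proj₁; proj₂)
open import Relation.Binary using (IsEquivalence)

record Category (o ℓ e : Level) : Set (suc (o ⊔ ℓ ⊔ e)) where
  infixr 9 _∘_
  infix  4 _≈_
  field
    Obj   : Set o
    Hom   : Obj → Obj → Set ℓ
    _≈_   : ∀ {A B} → Hom A B → Hom A B → Set e
    id    : ∀ {A} → Hom A A
    _∘_   : ∀ {A B C} → Hom B C → Hom A B → Hom A C
    equiv : ∀ {A B} → IsEquivalence (_≈_ {A} {B})
    assoc : ∀ {A B C D} {f : Hom A B} {g : Hom B C} {h : Hom C D} →
            (h ∘ g) ∘ f ≈ h ∘ (g ∘ f)
    identityˡ : ∀ {A B} {f : Hom A B} → id ∘ f ≈ f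
    identityʳ : ∀ {A B} {f : Hom A B} → f ∘ id ≈ f
    ∘-resp-≈  : ∀ {A B C} {f h : Hom B C} {g i : Hom A B} →
                f ≈ h → g ≈ i → f ∘ g ≈ h ∘ i

module _ {o ℓ e} (𝒞 : Category o ℓ e) where
  open Category 𝒞

  Mono : ∀ {A B} → Hom A B → Set (o ⊔ ℓ ⊔ e)
  Mono {A} f = ∀ {W} (g h : Hom W A) → f ∘ g ≈ f ∘ h → g ≈ h

  record IsPullback {P X Y Z} (f : Hom X Z) (g : Hom Y Z)
                    (p₁ : Hom P X) (p₂ : Hom P Y) : Set (o ⊔ ℓ ⊔ e) where
    field
      commute   : f ∘ p₁ ≈ g ∘ p₂
      universal : ∀ {W} (h : Hom W X) (k : Hom W Y) → f ∘ h ≈ g ∘ k →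
                  Σ[ u ∈ Hom W P ] (p₁ ∘ u ≈ h × p₂ ∘ u ≈ k ×
                    (∀ (v : Hom W P) → p₁ ∘ v ≈ h → p₂ ∘ v ≈ k → v ≈ u))

  record Pullback {X Y Z} (f : Hom X Z) (g : Hom Y Z) : Set (o ⊔ ℓ ⊔ e) where
    field
      P          : Obj
      p₁         : Hom P X
      p₂         : Hom P Y
      isPullback : IsPullback f g p₁ p₂

  IsTerminal : Obj → Set (o ⊔ ℓ ⊔ e)
  IsTerminal T = ∀ X → Σ[ t ∈ Hom X T ] (∀ (u : Hom X T) → u ≈ t)

  record IsProduct {P A B} (π₁ : Hom P A) (π₂ : Hom P B) : Set (o ⊔ ℓ ⊔ e) where
    field
      universal : ∀ {W} (f : Hom W A) (g : Hom W B) →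
                  Σ[ u ∈ Hom W P ] (π₁ ∘ u ≈ f × π₂ ∘ u ≈ g ×
                    (∀ (v : Hom W P) → π₁ ∘ v ≈ f → π₂ ∘ v ≈ g → v ≈ u))

  record Product (A B : Obj) : Set (o ⊔ ℓ ⊔ e) where
    field
      A×B       : Obj
      π₁        : Hom A×B A
      π₂        : Hom A×B B
      isProduct : IsProduct π₁ π₂

record Topos (o ℓ e : Level) : Set (suc (o ⊔ ℓ ⊔ e)) where
  field
    cat : Category o ℓ e
  open Category cat
  field
    ⊤          : Obj
    ⊤-terminal : IsTerminal cat ⊤
    product    : ∀ A B → Product cat A B
    pullback   : ∀ {X Y Z} (f : Hom X Z) (g : Hom Y Z) → Pullback cat f g

  ! : ∀ {X} → Hom X ⊤
  ! {X} = proj₁ (⊤-terminal X)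

  _×o_ : Obj → Obj → Obj
  A ×o B = Product.A×B (product A B)

  ⟨_,_⟩ : ∀ {W A B} → Hom W A → Hom W B → Hom W (A ×o B)
  ⟨ f , g ⟩ = proj₁ (IsProduct.universal (Product.isProduct (product _ _)) f g)

  _⊗_ : ∀ {A B C D} → Hom A C → Hom B D → Hom (A ×o B) (C ×o D)
  f ⊗ g = ⟨ f ∘ Product.π₁ (product _ _) , g ∘ Product.π₂ (product _ _) ⟩

  field
    _^_   : Obj → Obj → Obj
    eval  : ∀ {A B} → Hom ((B ^ A) ×o A) B
    curry : ∀ {C A B} (f : Hom (C ×o A) B) →
            Σ[ g ∈ Hom C (B ^ A) ] (eval ∘ (g ⊗ id) ≈ f ×
              (∀ (h : Hom C (B ^ A)) → eval ∘ (h ⊗ id) ≈ f → h ≈ g))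
    Ω     : Obj
    true  : Hom ⊤ Ω
    classify : ∀ {M X} (m : Hom M X) → Mono cat m →
               Σ[ χ ∈ Hom X Ω ] (IsPullback cat χ true m ! ×
                 (∀ (χ' : Hom X Ω) → IsPullback cat χ' true m ! → χ' ≈ χ))

record Endofunctor {o ℓ e} (𝒞 : Category o ℓ e) : Set (o ⊔ ℓ ⊔ e) where
  open Category 𝒞
  field
    F₀ : Obj → Obj
    F₁ : ∀ {A B} → Hom A B → Hom (F₀ A) (F₀ B)
    identity     : ∀ {A} → F₁ (id {A}) ≈ id
    homomorphism : ∀ {A B C} {f : Hom A B} {g : Hom B C} →
                   F₁ (g ∘ f) ≈ F₁ g ∘ F₁ f
    F-resp-≈     : ∀ {A B} {f g : Hom A B} → f ≈ g → F₁ f ≈ F₁ g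

record GuardedModel {o ℓ e} (𝓔 : Topos o ℓ e) : Set (o ⊔ ℓ ⊔ e) where
  open Topos 𝓔
  open Category cat
  field
    later : Endofunctor cat
  open Endofunctor later renaming (F₀ to ▶₀; F₁ to ▶₁)
  field
    pres-terminal : ∀ {T} → IsTerminal cat T → IsTerminal cat (▶₀ T)
    pres-pullback : ∀ {P X Y Z} {f : Hom X Z} {g : Hom Y Z}
                      {p₁ : Hom P X} {p₂ : Hom P Y} →
                    IsPullback cat f g p₁ p₂ →
                    IsPullback cat (▶₁ f) (▶₁ g) (▶₁ p₁) (▶₁ p₂)
    next     : ∀ {X} → Hom X (▶₀ X)
    next-nat : ∀ {X Y} (f : Hom X Y) → next ∘ f ≈ ▶₁ f ∘ next
    fix      : ∀ {X} (f : Hom (▶₀ X) X) →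
               Σ[ h ∈ Hom ⊤ X ] (f ∘ next ∘ h ≈ h ×
                 (∀ (h' : Hom ⊤ X) → f ∘ next ∘ h' ≈ h' → h' ≈ h))

  ▷ : ∀ {M X} → Hom M X → Σ[ D ∈ Obj ] Hom D X
  ▷ m = _ , Pullback.p₂ (pullback (▶₁ m) next)

  _≤_ : ∀ {M N X} → Hom M X → Hom N X → Set (ℓ ⊔ e)
  _≤_ {M} {N} m n = Σ[ u ∈ Hom M N ] n ∘ u ≈ m

  _∧_ : ∀ {M N X} → Hom M X → Hom N X → Σ[ D ∈ Obj ] Hom D X
  m ∧ n = _ , m ∘ Pullback.p₁ (pullback m n)

  -- The subobject [[ ▷ p ]] of Ω (p the free variable of type Ω), i.e. ▷ true
  ▷true : Σ[ D ∈ Obj ] Hom D Ω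
  ▷true = ▷ true

  -- Its interpretation is the subobject ((▷T ⇒ T) ⇒ T) of Ω, with T = [[p]] = true;
  -- validity means this is all of Ω, i.e. (by the universal property of
  -- Heyting implication in Sub(Ω)) every subobject S of Ω with
  -- S ∧ ▷T ≤ T satisfies S ≤ T.
  LöbInductionValid : Set (o ⊔ ℓ ⊔ e)
  LöbInductionValid =
    ∀ {S} (s : Hom S Ω) → Mono cat s →
    proj₂ (s ∧ proj₂ ▷true) ≤ true → s ≤ true

{-# OPTIONS --safe #-}
module Submission where

-- Let ψ : ▶Ω → Ω classify ▶ true, so that ψ ∘ next is ▷ on Ω.  Every generalised truth
-- value p satisfies p → ▷ p, and the hypothesis supplies ▷ p → p for p in S; hence the
-- inclusion s : S → Ω is a fixed point of ψ ∘ next, and so is the constant true.  Guarded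
-- fixed points are unique not only at global elements but at every stage S: the fixed
-- points of ψ ∘ next at stage S are the global fixed points of its pointwise action on
-- the exponential Ω ^ S.  Hence s = true ∘ !, i.e. S ≤ true.

open import Level using (Level)
open import Data.Product using (_,_; proj₁; proj₂)
open import Relation.Binary using (IsEquivalence; Setoid)
import Relation.Binary.Reasoning.Setoid as SetoidReasoning
open import Defs

module Reasoning {o ℓ e} (𝒞 : Category o ℓ e) where
  open Category 𝒞

  module _ {A B : Obj} where
    open IsEquivalence (equiv {A} {B}) public
      renaming (refl to ≈-refl; sym to ≈-sym; trans to ≈-trans)

  hom-setoid : Obj → Obj → Setoid ℓ e
  hom-setoid A B = record { Carrier = Hom A B ; _≈_ = Category._≈_ 𝒞 ; isEquivalence = equiv }

  module HomReasoning {A B : Obj} = SetoidReasoning (hom-setoid A B)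
  open HomReasoning public

  infixr 4 _⟩∘⟨_ refl⟩∘⟨_
  infixl 5 _⟩∘⟨refl

  _⟩∘⟨_ : ∀ {A B C} {f h : Hom B C} {g i : Hom A B} → f ≈ h → g ≈ i → f ∘ g ≈ h ∘ i
  _⟩∘⟨_ = ∘-resp-≈

  refl⟩∘⟨_ : ∀ {A B C} {f : Hom B C} {g i : Hom A B} → g ≈ i → f ∘ g ≈ f ∘ i
  refl⟩∘⟨ p = ≈-refl ⟩∘⟨ p

  _⟩∘⟨refl : ∀ {A B C} {f h : Hom B C} {g : Hom A B} → f ≈ h → f ∘ g ≈ h ∘ g
  p ⟩∘⟨refl = p ⟩∘⟨ ≈-refl

  sym-assoc : ∀ {A B C D} {f : Hom A B} {g : Hom B C} {h : Hom C D} →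
              h ∘ (g ∘ f) ≈ (h ∘ g) ∘ f
  sym-assoc = ≈-sym assoc

  pullˡ : ∀ {A B C D} {a : Hom C D} {b : Hom B C} {c : Hom B D} {f : Hom A B} →
          a ∘ b ≈ c → a ∘ (b ∘ f) ≈ c ∘ f
  pullˡ p = ≈-trans sym-assoc (p ⟩∘⟨refl)

  pullʳ : ∀ {A B C D} {a : Hom C D} {b : Hom B C} {f : Hom A B} {c : Hom A C} →
          b ∘ f ≈ c → (a ∘ b) ∘ f ≈ a ∘ c
  pullʳ p = ≈-trans assoc (refl⟩∘⟨ p)

module Properties {o ℓ e} (𝒞 : Category o ℓ e) where
  open Category 𝒞
  open Reasoning 𝒞

  terminal-unique : ∀ {T X} → IsTerminal 𝒞 T → (f g : Hom X T) → f ≈ g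
  terminal-unique {X = X} T-terminal f g =
    ≈-trans (proj₂ (T-terminal X) f) (≈-sym (proj₂ (T-terminal X) g))

  from-terminal-mono : ∀ {T X} → IsTerminal 𝒞 T → (f : Hom T X) → Mono 𝒞 f
  from-terminal-mono T-terminal _ g h _ = terminal-unique T-terminal g h

  module _ {P X Y Z} {f : Hom X Z} {g : Hom Y Z} {p₁ : Hom P X} {p₂ : Hom P Y}
           (pb : IsPullback 𝒞 f g p₁ p₂) where
    open IsPullback pb

    pullback-unique : ∀ {W} {u v : Hom W P} →
                      p₁ ∘ u ≈ p₁ ∘ v → p₂ ∘ u ≈ p₂ ∘ v → u ≈ v
    pullback-unique {u = u} {v} eq₁ eq₂ =
      ≈-trans (mediator-unique u ≈-refl ≈-refl)
              (≈-sym (mediator-unique v (≈-sym eq₁) (≈-sym eq₂)))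
      where
      square : f ∘ (p₁ ∘ u) ≈ g ∘ (p₂ ∘ u)
      square = ≈-trans sym-assoc (≈-trans (commute ⟩∘⟨refl) assoc)
      mediator-unique = proj₂ (proj₂ (proj₂ (universal (p₁ ∘ u) (p₂ ∘ u) square)))

    pullback-mono : Mono 𝒞 g → Mono 𝒞 p₁
    pullback-mono g-mono u v eq₁ = pullback-unique eq₁ (g-mono _ _ square)
      where
      square : g ∘ (p₂ ∘ u) ≈ g ∘ (p₂ ∘ v)
      square = begin
        g ∘ (p₂ ∘ u)  ≈⟨ pullˡ (≈-sym commute) ⟩
        (f ∘ p₁) ∘ u  ≈⟨ pullʳ eq₁ ⟩
        f ∘ (p₁ ∘ v)  ≈⟨ pullˡ commute ⟩
        (g ∘ p₂) ∘ v  ≈⟨ assoc ⟩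
        g ∘ (p₂ ∘ v)  ∎

    pullback-resp-≈₂ : ∀ {p₂′ : Hom P Y} → p₂ ≈ p₂′ → IsPullback 𝒞 f g p₁ p₂′
    pullback-resp-≈₂ eq = record
      { commute   = ≈-trans commute (refl⟩∘⟨ eq)
      ; universal = λ h k square →
          let (u , p₁u , p₂u , unique) = universal h k square in
          u , p₁u , ≈-trans (≈-sym eq ⟩∘⟨refl) p₂u ,
          λ v p₁v p₂′v → unique v p₁v (≈-trans (eq ⟩∘⟨refl) p₂′v) }

module ToposProperties {o ℓ e} (𝓔 : Topos o ℓ e) where
  open Topos 𝓔
  open Category cat
  open Reasoning cat
  open Properties cat

  !-unique : ∀ {X} (f : Hom X ⊤) → f ≈ !
  !-unique {X} = proj₂ (⊤-terminal X)

  π₁ : ∀ {A B} → Hom (A ×o B) A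
  π₁ {A} {B} = Product.π₁ (product A B)

  π₂ : ∀ {A B} → Hom (A ×o B) B
  π₂ {A} {B} = Product.π₂ (product A B)

  module _ {W A B : Obj} (f : Hom W A) (g : Hom W B) where
    private
      pairing = IsProduct.universal (Product.isProduct (product A B)) f g

    π₁∘⟨⟩ : π₁ ∘ ⟨ f , g ⟩ ≈ f
    π₁∘⟨⟩ = proj₁ (proj₂ pairing)

    π₂∘⟨⟩ : π₂ ∘ ⟨ f , g ⟩ ≈ g
    π₂∘⟨⟩ = proj₁ (proj₂ (proj₂ pairing))

    ⟨⟩-unique : (v : Hom W (A ×o B)) → π₁ ∘ v ≈ f → π₂ ∘ v ≈ g → v ≈ ⟨ f , g ⟩
    ⟨⟩-unique = proj₂ (proj₂ (proj₂ pairing))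

  ⟨⟩-cong : ∀ {W A B} {f f′ : Hom W A} {g g′ : Hom W B} →
            f ≈ f′ → g ≈ g′ → ⟨ f , g ⟩ ≈ ⟨ f′ , g′ ⟩
  ⟨⟩-cong {f = f} {f′} {g} {g′} p q =
    ⟨⟩-unique f′ g′ ⟨ f , g ⟩ (≈-trans (π₁∘⟨⟩ f g) p) (≈-trans (π₂∘⟨⟩ f g) q)

  ⊗-cong : ∀ {A B C D} {f f′ : Hom A C} {g g′ : Hom B D} →
           f ≈ f′ → g ≈ g′ → f ⊗ g ≈ f′ ⊗ g′
  ⊗-cong p q = ⟨⟩-cong (p ⟩∘⟨refl) (q ⟩∘⟨refl)

  ⊗∘⊗ : ∀ {A₁ A₂ B₁ B₂ C₁ C₂} {f : Hom B₁ C₁} {g : Hom B₂ C₂}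
          {h : Hom A₁ B₁} {k : Hom A₂ B₂} →
        (f ⊗ g) ∘ (h ⊗ k) ≈ (f ∘ h) ⊗ (g ∘ k)
  ⊗∘⊗ {f = f} {g} {h} {k} = ⟨⟩-unique _ _ _
    (≈-trans (pullˡ (π₁∘⟨⟩ _ _)) (≈-trans (pullʳ (π₁∘⟨⟩ _ _)) sym-assoc))
    (≈-trans (pullˡ (π₂∘⟨⟩ _ _)) (≈-trans (pullʳ (π₂∘⟨⟩ _ _)) sym-assoc))

  ∘⊗id : ∀ {A B C D} {g : Hom B C} {h : Hom A B} →
         (g ∘ h) ⊗ id {D} ≈ (g ⊗ id) ∘ (h ⊗ id)
  ∘⊗id = ≈-sym (≈-trans ⊗∘⊗ (⊗-cong ≈-refl identityˡ))

  ⌜_⌝ : ∀ {S Y} → Hom S Y → Hom ⊤ (Y ^ S)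
  ⌜ a ⌝ = proj₁ (curry (a ∘ π₂))

  eval∘⌜⌝ : ∀ {S Y} (a : Hom S Y) → eval ∘ (⌜ a ⌝ ⊗ id) ≈ a ∘ π₂
  eval∘⌜⌝ a = proj₁ (proj₂ (curry (a ∘ π₂)))

  ⌜⌝-unique : ∀ {S Y} {a : Hom S Y} (h : Hom ⊤ (Y ^ S)) →
              eval ∘ (h ⊗ id) ≈ a ∘ π₂ → h ≈ ⌜ a ⌝
  ⌜⌝-unique {a = a} = proj₂ (proj₂ (curry (a ∘ π₂)))

  ⌜⌝-injective : ∀ {S Y} {a b : Hom S Y} → ⌜ a ⌝ ≈ ⌜ b ⌝ → a ≈ b
  ⌜⌝-injective {a = a} {b} eq =
    ≈-trans (uncurry-⌜⌝ a) (≈-sym (≈-trans (uncurry-⌜⌝ b) uncurry-cong))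
    where
    uncurry-⌜⌝ : ∀ c → c ≈ (eval ∘ (⌜ c ⌝ ⊗ id)) ∘ ⟨ ! , id ⟩
    uncurry-⌜⌝ c = begin
      c                                ≈⟨ ≈-sym identityʳ ⟩
      c ∘ id                           ≈⟨ refl⟩∘⟨ ≈-sym (π₂∘⟨⟩ ! id) ⟩
      c ∘ (π₂ ∘ ⟨ ! , id ⟩)            ≈⟨ sym-assoc ⟩
      (c ∘ π₂) ∘ ⟨ ! , id ⟩            ≈⟨ ≈-sym (eval∘⌜⌝ c) ⟩∘⟨refl ⟩
      (eval ∘ (⌜ c ⌝ ⊗ id)) ∘ ⟨ ! , id ⟩ ∎
    uncurry-cong : (eval ∘ (⌜ b ⌝ ⊗ id)) ∘ ⟨ ! , id ⟩ ≈ (eval ∘ (⌜ a ⌝ ⊗ id)) ∘ ⟨ ! , id ⟩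
    uncurry-cong = (refl⟩∘⟨ ⊗-cong (≈-sym eq) ≈-refl) ⟩∘⟨refl

  Ω-ext : ∀ {X} (χ χ′ : Hom X Ω) →
          (∀ {W} (a : Hom W X) → χ ∘ a ≈ true ∘ ! → χ′ ∘ a ≈ true ∘ !) →
          (∀ {W} (a : Hom W X) → χ′ ∘ a ≈ true ∘ ! → χ ∘ a ≈ true ∘ !) →
          χ ≈ χ′
  Ω-ext {X} χ χ′ to from =
    ≈-trans (classifies-k χ χ-pullback) (≈-sym (classifies-k χ′ χ′-pullback))
    where
    χ-true = pullback χ true
    k = Pullback.p₁ χ-true

    χ-pullback : IsPullback cat χ true k !
    χ-pullback = pullback-resp-≈₂ (Pullback.isPullback χ-true) (!-unique _)

    k-mono : Mono cat k
    k-mono = pullback-mono (Pullback.isPullback χ-true)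
                           (from-terminal-mono ⊤-terminal true)

    classifies-k = proj₂ (proj₂ (classify k k-mono))

    χ′-pullback : IsPullback cat χ′ true k !
    χ′-pullback = record
      { commute   = to k (IsPullback.commute χ-pullback)
      ; universal = λ h t square → IsPullback.universal χ-pullback h t
          (≈-trans (from h (≈-trans square (refl⟩∘⟨ !-unique t)))
                   (refl⟩∘⟨ ≈-sym (!-unique t))) }

module Guarded {o ℓ e} {𝓔 : Topos o ℓ e} (G : GuardedModel 𝓔) where
  open Topos 𝓔
  open Category cat
  open Reasoning cat
  open Properties cat
  open ToposProperties 𝓔
  open GuardedModel G
  open Endofunctor later renaming (F₀ to ▶₀; F₁ to ▶₁)

  ▶⊤-terminal : IsTerminal cat (▶₀ ⊤)
  ▶⊤-terminal = pres-terminal ⊤-terminal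

  ×-pullback : ∀ {X Y} → IsPullback cat (! {X}) (! {Y}) π₁ π₂
  ×-pullback = record
    { commute   = terminal-unique ⊤-terminal _ _
    ; universal = λ h k _ → ⟨ h , k ⟩ , π₁∘⟨⟩ h k , π₂∘⟨⟩ h k , ⟨⟩-unique h k }

  ▶×-pullback : ∀ {X Y} → IsPullback cat (▶₁ (! {X})) (▶₁ (! {Y})) (▶₁ π₁) (▶₁ π₂)
  ▶×-pullback = pres-pullback ×-pullback

  ▶×-comparison : ∀ {X Y} → Hom (▶₀ X ×o ▶₀ Y) (▶₀ (X ×o Y))
  ▶×-comparison =
    proj₁ (IsPullback.universal ▶×-pullback π₁ π₂ (terminal-unique ▶⊤-terminal _ _))

  ▶π₁∘▶×-comparison : ∀ {X Y} → ▶₁ π₁ ∘ ▶×-comparison {X} {Y} ≈ π₁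
  ▶π₁∘▶×-comparison = proj₁ (proj₂
    (IsPullback.universal ▶×-pullback π₁ π₂ (terminal-unique ▶⊤-terminal _ _)))

  ▶π₂∘▶×-comparison : ∀ {X Y} → ▶₁ π₂ ∘ ▶×-comparison {X} {Y} ≈ π₂
  ▶π₂∘▶×-comparison = proj₁ (proj₂ (proj₂
    (IsPullback.universal ▶×-pullback π₁ π₂ (terminal-unique ▶⊤-terminal _ _))))

  ▶×-comparison∘next⊗next : ∀ {X Y} → ▶×-comparison ∘ (next ⊗ next) ≈ next {X ×o Y}
  ▶×-comparison∘next⊗next = pullback-unique ▶×-pullback
    (≈-trans (pullˡ ▶π₁∘▶×-comparison) (≈-trans (π₁∘⟨⟩ _ _) (next-nat π₁)))
    (≈-trans (pullˡ ▶π₂∘▶×-comparison) (≈-trans (π₂∘⟨⟩ _ _) (next-nat π₂)))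

  module Pointwise {Y : Obj} (f : Hom (▶₀ Y) Y) (S : Obj) where

    uncurried : Hom (▶₀ (Y ^ S) ×o S) Y
    uncurried = f ∘ ▶₁ eval ∘ ▶×-comparison ∘ (id ⊗ next)

    pointwise : Hom (▶₀ (Y ^ S)) (Y ^ S)
    pointwise = proj₁ (curry uncurried)

    uncurried∘next⊗id : ∀ {W} (h : Hom W (Y ^ S)) →
                        uncurried ∘ ((next ∘ h) ⊗ id) ≈ f ∘ next ∘ eval ∘ (h ⊗ id)
    uncurried∘next⊗id h = begin
      uncurried ∘ ((next ∘ h) ⊗ id)
        ≈⟨ ≈-trans assoc (refl⟩∘⟨ ≈-trans assoc (refl⟩∘⟨ assoc)) ⟩
      f ∘ ▶₁ eval ∘ ▶×-comparison ∘ (id ⊗ next) ∘ ((next ∘ h) ⊗ id)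
        ≈⟨ refl⟩∘⟨ refl⟩∘⟨ refl⟩∘⟨ interchange ⟩
      f ∘ ▶₁ eval ∘ ▶×-comparison ∘ (next ⊗ next) ∘ (h ⊗ id)
        ≈⟨ refl⟩∘⟨ refl⟩∘⟨ pullˡ ▶×-comparison∘next⊗next ⟩
      f ∘ ▶₁ eval ∘ next ∘ (h ⊗ id)
        ≈⟨ refl⟩∘⟨ ≈-trans (pullˡ (≈-sym (next-nat eval))) assoc ⟩
      f ∘ next ∘ eval ∘ (h ⊗ id) ∎
      where
      interchange : (id ⊗ next) ∘ ((next ∘ h) ⊗ id) ≈ (next ⊗ next) ∘ (h ⊗ id)
      interchange = ≈-trans ⊗∘⊗ (≈-trans (⊗-cong identityˡ ≈-refl) (≈-sym ⊗∘⊗))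

    pointwise-fixes-⌜⌝ : {a : Hom S Y} → f ∘ next ∘ a ≈ a →
                         pointwise ∘ next ∘ ⌜ a ⌝ ≈ ⌜ a ⌝
    pointwise-fixes-⌜⌝ {a} fixed = ⌜⌝-unique _ (begin
      eval ∘ ((pointwise ∘ next ∘ ⌜ a ⌝) ⊗ id)     ≈⟨ refl⟩∘⟨ ∘⊗id ⟩
      eval ∘ (pointwise ⊗ id) ∘ ((next ∘ ⌜ a ⌝) ⊗ id) ≈⟨ pullˡ (proj₁ (proj₂ (curry uncurried))) ⟩
      uncurried ∘ ((next ∘ ⌜ a ⌝) ⊗ id)             ≈⟨ uncurried∘next⊗id ⌜ a ⌝ ⟩
      f ∘ next ∘ eval ∘ (⌜ a ⌝ ⊗ id)                ≈⟨ refl⟩∘⟨ refl⟩∘⟨ eval∘⌜⌝ a ⟩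
      f ∘ next ∘ a ∘ π₂                              ≈⟨ ≈-trans (refl⟩∘⟨ sym-assoc) sym-assoc ⟩
      (f ∘ next ∘ a) ∘ π₂                            ≈⟨ fixed ⟩∘⟨refl ⟩
      a ∘ π₂                                         ∎)

  guarded-fixed-point-unique : ∀ {S Y} (f : Hom (▶₀ Y) Y) {a b : Hom S Y} →
                               f ∘ next ∘ a ≈ a → f ∘ next ∘ b ≈ b → a ≈ b
  guarded-fixed-point-unique {S} f a-fixed b-fixed =
    ⌜⌝-injective (≈-trans (unique _ (pointwise-fixes-⌜⌝ a-fixed))
                          (≈-sym (unique _ (pointwise-fixes-⌜⌝ b-fixed))))
    where
    open Pointwise f S
    unique = proj₂ (proj₂ (fix pointwise))

  ▶true-mono : Mono cat (▶₁ true)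
  ▶true-mono = from-terminal-mono ▶⊤-terminal (▶₁ true)

  ψ : Hom (▶₀ Ω) Ω
  ψ = proj₁ (classify (▶₁ true) ▶true-mono)

  ψ-pullback : IsPullback cat ψ true (▶₁ true) !
  ψ-pullback = proj₁ (proj₂ (classify (▶₁ true) ▶true-mono))

  ψ∘next∘true : ψ ∘ next ∘ true ≈ true
  ψ∘next∘true = begin
    ψ ∘ next ∘ true         ≈⟨ refl⟩∘⟨ next-nat true ⟩
    ψ ∘ ▶₁ true ∘ next      ≈⟨ pullˡ (IsPullback.commute ψ-pullback) ⟩
    (true ∘ !) ∘ next       ≈⟨ pullʳ (terminal-unique ⊤-terminal _ id) ⟩
    true ∘ id               ≈⟨ identityʳ ⟩
    true                    ∎

  ψ∘next-preserves-true : ∀ {W} {x : Hom W Ω} → x ≈ true ∘ ! → ψ ∘ next ∘ x ≈ true ∘ !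
  ψ∘next-preserves-true {x = x} x-true = begin
    ψ ∘ next ∘ x            ≈⟨ refl⟩∘⟨ refl⟩∘⟨ x-true ⟩
    ψ ∘ next ∘ true ∘ !     ≈⟨ ≈-trans (refl⟩∘⟨ sym-assoc) sym-assoc ⟩
    (ψ ∘ next ∘ true) ∘ !   ≈⟨ ψ∘next∘true ⟩∘⟨refl ⟩
    true ∘ !                ∎

  ψ∘next-true⇒≤▷true : ∀ {W} (x : Hom W Ω) → ψ ∘ next ∘ x ≈ true ∘ ! → x ≤ proj₂ ▷true
  ψ∘next-true⇒≤▷true x ▷x-true = u , d∘u
    where
    ▶true-factor = IsPullback.universal ψ-pullback (next ∘ x) ! ▷x-true
    ▷true-factor = IsPullback.universal (Pullback.isPullback (pullback (▶₁ true) next))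
                     (proj₁ ▶true-factor) x (proj₁ (proj₂ ▶true-factor))
    u = proj₁ ▷true-factor
    d∘u = proj₁ (proj₂ (proj₂ ▷true-factor))

  ∧-≤-factor : ∀ {M N K X W} (m : Hom M X) (n : Hom N X) (k : Hom K X) →
               proj₂ (m ∧ n) ≤ k → (a : Hom W M) → (m ∘ a) ≤ n → (m ∘ a) ≤ k
  ∧-≤-factor m n k (v , k∘v) a (u , n∘u) = v ∘ proj₁ meet-factor , (begin
    k ∘ v ∘ proj₁ meet-factor  ≈⟨ pullˡ k∘v ⟩
    (m ∘ p₁) ∘ proj₁ meet-factor ≈⟨ pullʳ (proj₁ (proj₂ meet-factor)) ⟩
    m ∘ a                      ∎)
    where
    m∧n = pullback m n
    p₁ = Pullback.p₁ m∧n
    meet-factor = IsPullback.universal (Pullback.isPullback m∧n) a u (≈-sym n∘u)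

  ψ∘next-fixes : ∀ {S} (s : Hom S Ω) → proj₂ (s ∧ proj₂ ▷true) ≤ true → ψ ∘ next ∘ s ≈ s
  ψ∘next-fixes {S} s s∧▷true≤true = Ω-ext (ψ ∘ next ∘ s) s ▷-elim ▷-intro
    where
    reassoc : ∀ {W} (a : Hom W S) → (ψ ∘ next ∘ s) ∘ a ≈ ψ ∘ next ∘ s ∘ a
    reassoc a = ≈-trans assoc (refl⟩∘⟨ assoc)

    ▷-elim : ∀ {W} (a : Hom W S) → (ψ ∘ next ∘ s) ∘ a ≈ true ∘ ! → s ∘ a ≈ true ∘ !
    ▷-elim a ▷sa-true =
      let (t , true∘t) = ∧-≤-factor s (proj₂ ▷true) true s∧▷true≤true a
                           (ψ∘next-true⇒≤▷true (s ∘ a) (≈-trans (≈-sym (reassoc a)) ▷sa-true))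
      in ≈-trans (≈-sym true∘t) (refl⟩∘⟨ !-unique t)

    ▷-intro : ∀ {W} (a : Hom W S) → s ∘ a ≈ true ∘ ! → (ψ ∘ next ∘ s) ∘ a ≈ true ∘ !
    ▷-intro a sa-true = ≈-trans (reassoc a) (ψ∘next-preserves-true sa-true)

theorem6p8 : ∀ {o ℓ e : Level} (𝓔 : Topos o ℓ e) (G : GuardedModel 𝓔) →
    GuardedModel.LöbInductionValid G
theorem6p8 𝓔 G s _ s∧▷true≤true = ! , ≈-sym s≈true
  where
  open Topos 𝓔
  open Category cat using (_≈_; _∘_)
  open Reasoning cat
  open Guarded G

  s≈true : s ≈ true ∘ !
  s≈true = guarded-fixed-point-unique ψ
             (ψ∘next-fixes s s∧▷true≤true)
             (ψ∘next-preserves-true ≈-refl)
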